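{- (1) $S_{3,1,1}\not\le C_4$. (2) For every integer $k\ge 5$, $S_{3,1,1}\le C_k$.
   Context: All graphs are finite and simple, considered up to isomorphism. An edge-colored graph is a pair $(G,c)$ with $c\colon E(G)\to\mathbb{N}$ an arbitrary map (not necessarily proper); it is colored in $t$ or more colors if $|c(E(G))|\ge t$. A subgraph (not necessarily induced) is rainbow if its edges receive pairwise distinct colors. $(G,c)$ is rainbow $H$-free if $G$ contains no rainbow subgraph isomorphic to $H$. For graphs $H_1,H_2$, write $H_1\le H_2$ if there is a positive integer $t$ such that every rainbow $H_1$-free edge-colored complete graph colored in $t$ or more colors is rainbow $H_2$-free. $C_k$ is the cycle on $k$ vertices. For positive integers $a,b,c$, $S_{a,b,c}$ is the tree consisting of one vertex (the branch vertex) joined by three internally disjoint paths of lengths $a$, $b$, $c$; it has $a+b+c+1$ vertices. -}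

module Defs where

open import Data.Nat using (ℕ; zero; suc; _≤_; _<_)
open import Data.Nat.DivMod using (_mod_)
open import Data.Fin using (Fin; zero; suc; toℕ)
open import Data.Product using (Σ; ∃; _×_; _,_; proj₁; proj₂)
open import Relation.Binary.PropositionalEquality using (_≡_; _≢_)
open import Relation.Nullary using (¬_)
open import Function.Definitions using (Injective)

-- A finite simple graph H, given by its vertex set Fin vertices and a list
-- of its edges indexed by Fin edges; edge k joins the two endpoints of (edge k).
-- (Well-formedness — distinct endpoints, no repeated edges — holds for the
-- concrete graphs defined below.)
record Graph : Set where
  field
    vertices : ℕ
    edges    : ℕ
    edge     : Fin edges → Fin vertices × Fin vertices
open Graph public

-- An edge-colouring of the complete graph K_n on vertex set Fin n:
-- a symmetric map c; the value c i i (i not an edge) is never used.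
Symmetric : {n : ℕ} → (Fin n → Fin n → ℕ) → Set
Symmetric {n} c = (i j : Fin n) → c i j ≡ c j i

-- (K_n, c) is coloured in t or more colours: there are t edges
-- (pairs of distinct vertices) receiving pairwise distinct colours,
-- i.e. |c(E(K_n))| ≥ t.
AtLeastColours : (t : ℕ) {n : ℕ} → (Fin n → Fin n → ℕ) → Set
AtLeastColours t {n} c =
  Σ (Fin t → Fin n × Fin n) λ f →
    ((k : Fin t) → proj₁ (f k) ≢ proj₂ (f k)) ×
    Injective _≡_ _≡_ (λ k → c (proj₁ (f k)) (proj₂ (f k)))

-- (K_n, c) contains a rainbow subgraph isomorphic to H: an injective
-- vertex map φ : V(H) → V(K_n) (every pair of distinct vertices of K_n is
-- an edge) such that the images of the edges of H get pairwise distinct colours.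
HasRainbow : (H : Graph) {n : ℕ} → (Fin n → Fin n → ℕ) → Set
HasRainbow H {n} c =
  Σ (Fin (vertices H) → Fin n) λ φ →
    Injective _≡_ _≡_ φ ×
    Injective _≡_ _≡_ (λ k → c (φ (proj₁ (edge H k))) (φ (proj₂ (edge H k))))

RainbowFree : (H : Graph) {n : ℕ} → (Fin n → Fin n → ℕ) → Set
RainbowFree H c = ¬ HasRainbow H c

_≼_ : Graph → Graph → Set
H₁ ≼ H₂ = Σ ℕ λ t → 1 ≤ t ×
  ((n : ℕ) (c : Fin n → Fin n → ℕ) → Symmetric c →
     AtLeastColours t c → RainbowFree H₁ c → RainbowFree H₂ c)

-- The cycle C_k on vertex set Fin k, edges {i, i+1 mod k}.
-- (Only used for k ≥ 4; Cycle 0 is the empty graph.)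
Cycle : ℕ → Graph
Cycle zero = record { vertices = 0 ; edges = 0 ; edge = λ () }
Cycle (suc m) = record
  { vertices = suc m ; edges = suc m
  ; edge = λ i → i , (suc (toℕ i)) mod (suc m) }

-- S_{3,1,1}: branch vertex 0, path 0-1-2-3, and pendant edges 0-4, 0-5.
S311 : Graph
S311 = record { vertices = 6 ; edges = 5 ; edge = e }
  where
  e : Fin 5 → Fin 6 × Fin 6
  e zero = zero , suc zero
  e (suc zero) = suc zero , suc (suc zero)
  e (suc (suc zero)) = suc (suc zero) , suc (suc (suc zero))
  e (suc (suc (suc zero))) = zero , suc (suc (suc (suc zero)))
  e (suc (suc (suc (suc zero)))) = zero , suc (suc (suc (suc (suc zero))))

module Submission where

open import Defs
open import Data.Nat using (ℕ; _≤_)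
open import Data.Product using (_×_)
open import Relation.Nullary using (¬_)

open import Data.Bool using (if_then_else_)
open import Data.Empty using (⊥; ⊥-elim)
open import Data.Fin as Fin using (Fin; zero; suc; toℕ; punchIn)
open import Data.Fin.Patterns using (0F; 1F; 2F; 3F; 4F; 5F)
open import Data.Fin.Properties as Fin using (+↔⊎; *↔×)
open import Data.List using (List; []; _∷_; _∷ʳ_; lookup; map)
open import Data.List.Membership.Propositional using (_∈_; _∉_)
open import Data.List.Membership.Propositional.Properties using (∈-lookup)
open import Data.List.Relation.Unary.All as All using ()
open import Data.List.Relation.Unary.All.Properties as All using (All¬⇒¬Any)
open import Data.List.Relation.Unary.AllPairs as AllPairs using (allPairs?)
open import Data.List.Relation.Unary.AllPairs.Properties as AllPairs using ()
open import Data.List.Relation.Unary.Any using (here; there)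
open import Data.List.Relation.Unary.Unique.Propositional using (Unique; []; _∷_)
open import Data.Maybe using (Maybe; just; nothing)
open import Data.Nat as ℕ using (_+_; _*_; _∸_; _<_; z≤n; s≤s; NonZero)
open import Data.Nat.DivMod
  using (_mod_; _%_; _/_; m%n<n; m<n⇒m%n≡m; [m+n]%n≡m%n; %-distribˡ-+; m≡m%n+[m/n]*n)
open import Data.Nat.Divisibility using (divides; ∣⇒≤)
open import Data.Nat.Properties as ℕ using ()
open import Data.List.Membership.DecPropositional ℕ._≟_ using (_∈?_)
open import Data.Product using (Σ; ∃; _,_; proj₁; proj₂)
open import Data.Sum using (_⊎_; inj₁; inj₂; [_,_]′)
open import Data.Sum.Function.Propositional using (_⊎-↔_)
open import Data.Sum.Properties using (inj₁-injective)
open import Data.Unit using (⊤; tt)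
open import Function using (_∘_; case_of_; _↔_; Inverse; Injection)
open import Function.Definitions using (Injective)
open import Function.Properties.Inverse using (↔-refl; ↔-sym; ↔-trans; ↔⇒↣)
open import Relation.Binary.PropositionalEquality
open ≡-Reasoning
open import Relation.Nullary using (Dec; yes; no; does; ¬?)
open import Relation.Nullary.Decidable
  using (True; toWitness; from-yes; _→-dec_; _⊎-dec_; _×-dec_)

-- (1) Colour K_{4+2t} so that four vertices carry a rainbow C₄ in colours 1–4, the other 2t
-- vertices are joined by a perfect matching whose j-th edge has colour 5 + j, and all
-- remaining edges have colour 0.  The edges of nonzero colour form C₄ plus a matching: every
-- component has at most four vertices, a component with three vertices is the C₄, and no
-- vertex has three nonzero neighbours.  A rainbow S₃,₁,₁ has at most one edge of colour 0,
-- and whichever edge that is, what is left violates one of these bounds.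
--
-- (2) Let c be rainbow-S₃,₁,₁-free with a rainbow cycle w₀ … w_{k-1} (k ≥ 5, cycle edge
-- colours e_p) and more than k² colours.  Some edge xy then has a colour γ not used on any
-- pair of cycle vertices.  If x = w_p, then w_p w_{p+1} w_{p+2} w_{p+3} with leaves w_{p-1}
-- and y is rainbow; so x and y lie off the cycle.  For z off the cycle, a rainbow spider
-- with long leg along the cycle forces c(z, w_p) ∈ {e_{p-1}, …, e_{p+2}}, and with the leg in
-- the other direction c(z, w_p) ∈ {e_{p-3}, …, e_p}; hence c(z, w_p) is e_{p-1} or e_p, or
-- k = 5 and it is the opposite colour e_{p+2}.  A few cases then give a rainbow S₃,₁,₁ with
-- branch vertex x, long leg along the cycle and y as a leaf; for k = 5 the only survivor is
-- that x and y both see every w_p in colour e_{p+2}, and then x y w₃ w₄ with leaves w₀, w₂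
-- at x is rainbow.

RainbowCopy : (H : Graph) {V : Set} → (V → V → ℕ) → Set
RainbowCopy H {V} col =
  Σ (Fin (vertices H) → V) λ φ →
    Injective _≡_ _≡_ φ ×
    Injective _≡_ _≡_ (λ r → col (φ (proj₁ (edge H r))) (φ (proj₂ (edge H r))))

rainbowCopy-map : {V V′ : Set} {col : V → V → ℕ} {col′ : V′ → V′ → ℕ} (H : Graph)
  (f : V → V′) → Injective _≡_ _≡_ f → (∀ u v → col′ (f u) (f v) ≡ col u v) →
  RainbowCopy H col → RainbowCopy H col′
rainbowCopy-map H f f-injective f-preserves (φ , φ-injective , colours-injective) =
  f ∘ φ , φ-injective ∘ f-injective ,
  λ eq → colours-injective (trans (sym (f-preserves _ _)) (trans eq (f-preserves _ _)))

lookup-injective : {A : Set} {xs : List A} → Unique xs → Injective _≡_ _≡_ (lookup xs)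
lookup-injective {xs = _ ∷ _} (_ ∷ _) {zero} {zero} _ = refl
lookup-injective {xs = _ ∷ _} (x∉xs ∷ _) {zero} {suc j} eq =
  ⊥-elim (All.lookup x∉xs (∈-lookup j) eq)
lookup-injective {xs = _ ∷ _} (x∉xs ∷ _) {suc i} {zero} eq =
  ⊥-elim (All.lookup x∉xs (∈-lookup i) (sym eq))
lookup-injective {xs = _ ∷ _} (_ ∷ xs!) {suc i} {suc j} eq = cong suc (lookup-injective xs! eq)

unique-∷ʳ : {A : Set} {xs : List A} {x : A} → Unique xs → x ∉ xs → Unique (xs ∷ʳ x)
unique-∷ʳ {xs = []} [] _ = All.[] ∷ []
unique-∷ʳ {xs = _ ∷ _} (y∉ys ∷ ys!) x∉ =
  All.∷ʳ⁺ y∉ys (λ y≡x → x∉ (here (sym y≡x))) ∷ unique-∷ʳ ys! (x∉ ∘ there)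

module _ {n : ℕ} (c : Fin n → Fin n → ℕ) where

  S311-rainbow : {b p₁ p₂ p₃ q₁ q₂ : Fin n} {κ₁ κ₂ κ₃ κ₄ κ₅ : ℕ} →
    c b p₁ ≡ κ₁ → c p₁ p₂ ≡ κ₂ → c p₂ p₃ ≡ κ₃ → c b q₁ ≡ κ₄ → c b q₂ ≡ κ₅ →
    Unique (b ∷ p₁ ∷ p₂ ∷ p₃ ∷ q₁ ∷ q₂ ∷ []) → Unique (κ₁ ∷ κ₂ ∷ κ₃ ∷ κ₄ ∷ κ₅ ∷ []) →
    HasRainbow S311 c
  S311-rainbow {b} {p₁} {p₂} {p₃} {q₁} {q₂} refl refl refl refl refl vs! κs! =
    lookup vs , lookup-injective vs! ,
    λ {r} {s} eq → lookup-injective κs! (trans (edge-colour r) (trans eq (sym (edge-colour s))))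
    where
    vs = b ∷ p₁ ∷ p₂ ∷ p₃ ∷ q₁ ∷ q₂ ∷ []
    edge-colour : ∀ r →
      lookup (c b p₁ ∷ c p₁ p₂ ∷ c p₂ p₃ ∷ c b q₁ ∷ c b q₂ ∷ []) r ≡
      c (lookup vs (proj₁ (edge S311 r))) (lookup vs (proj₂ (edge S311 r)))
    edge-colour 0F = refl
    edge-colour 1F = refl
    edge-colour 2F = refl
    edge-colour 3F = refl
    edge-colour 4F = refl

  S311-last-leaf : RainbowFree S311 c →
    {b p₁ p₂ p₃ q₁ q₂ : Fin n} {κ₁ κ₂ κ₃ κ₄ : ℕ} →
    c b p₁ ≡ κ₁ → c p₁ p₂ ≡ κ₂ → c p₂ p₃ ≡ κ₃ → c b q₁ ≡ κ₄ →
    Unique (b ∷ p₁ ∷ p₂ ∷ p₃ ∷ q₁ ∷ q₂ ∷ []) → Unique (κ₁ ∷ κ₂ ∷ κ₃ ∷ κ₄ ∷ []) →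
    c b q₂ ∈ κ₁ ∷ κ₂ ∷ κ₃ ∷ κ₄ ∷ []
  S311-last-leaf free {b} {q₂ = q₂} e₁ e₂ e₃ e₄ vs! κs! with c b q₂ ∈? _
  ... | yes ∈κs = ∈κs
  ... | no ∉κs  = ⊥-elim (free (S311-rainbow e₁ e₂ e₃ e₄ refl vs! (unique-∷ʳ κs! ∉κs)))

-- The counterexample for C₄

C4-colour : Fin 4 → Fin 4 → ℕ
C4-colour 0F 1F = 1
C4-colour 1F 0F = 1
C4-colour 1F 2F = 2
C4-colour 2F 1F = 2
C4-colour 2F 3F = 3
C4-colour 3F 2F = 3
C4-colour 3F 0F = 4
C4-colour 0F 3F = 4
C4-colour _  _  = 0

C4-colour-sym : ∀ i j → C4-colour i j ≡ C4-colour j i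
C4-colour-sym = from-yes (Fin.all? λ i → Fin.all? λ j → C4-colour i j ℕ.≟ C4-colour j i)

C4-rainbow : ∀ i j → C4-colour i (ℕ.suc (toℕ i) mod 4) ≡ C4-colour j (ℕ.suc (toℕ j) mod 4) → i ≡ j
C4-rainbow = from-yes (Fin.all? λ i → Fin.all? λ j →
  (C4-colour i (ℕ.suc (toℕ i) mod 4) ℕ.≟ C4-colour j (ℕ.suc (toℕ j) mod 4)) →-dec (i Fin.≟ j))

C4-two-neighbours : ∀ i u v w → C4-colour i u ≢ 0 → C4-colour i v ≢ 0 → C4-colour i w ≢ 0 →
  u ≡ v ⊎ u ≡ w ⊎ v ≡ w
C4-two-neighbours = from-yes (Fin.all? λ i → Fin.all? λ u → Fin.all? λ v → Fin.all? λ w →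
  ¬? (C4-colour i u ℕ.≟ 0) →-dec ¬? (C4-colour i v ℕ.≟ 0) →-dec ¬? (C4-colour i w ℕ.≟ 0) →-dec
  (u Fin.≟ v ⊎-dec u Fin.≟ w ⊎-dec v Fin.≟ w))

Fin2-pigeonhole : ∀ (a b c : Fin 2) → a ≡ b ⊎ a ≡ c ⊎ b ≡ c
Fin2-pigeonhole = from-yes (Fin.all? λ (a : Fin 2) → Fin.all? λ b → Fin.all? λ c →
  a Fin.≟ b ⊎-dec a Fin.≟ c ⊎-dec b Fin.≟ c)

Vertex : ℕ → Set
Vertex t = Fin 4 ⊎ (Fin t × Fin 2)

pattern cyc i = inj₁ i
pattern end j a = inj₂ (j , a)

colour : {t : ℕ} → Vertex t → Vertex t → ℕ
colour (cyc i)   (cyc i′)   = C4-colour i i′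
colour (end j _) (end j′ _) = if does (j Fin.≟ j′) then 5 + toℕ j else 0
colour _         _          = 0

colour-sym : {t : ℕ} (u v : Vertex t) → colour u v ≡ colour v u
colour-sym (cyc i)   (cyc i′)   = C4-colour-sym i i′
colour-sym (cyc _)   (end _ _)  = refl
colour-sym (end _ _) (cyc _)    = refl
colour-sym (end j _) (end j′ _) with j Fin.≟ j′ | j′ Fin.≟ j
... | yes refl | yes _    = refl
... | yes refl | no j≢j   = ⊥-elim (j≢j refl)
... | no j≢j′  | yes j′≡j = ⊥-elim (j≢j′ (sym j′≡j))
... | no _     | no _     = refl

matching-colour : {t : ℕ} (j : Fin t) → colour (end j 0F) (end j 1F) ≡ 5 + toℕ j
matching-colour j with j Fin.≟ j
... | yes _  = refl
... | no j≢j = ⊥-elim (j≢j refl)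

component : {t : ℕ} → Vertex t → Maybe (Fin t)
component (cyc _)   = nothing
component (end j _) = just j

same-component : {t : ℕ} (u v : Vertex t) → colour u v ≢ 0 → component u ≡ component v
same-component (cyc _)   (cyc _)    _    = refl
same-component (cyc _)   (end _ _)  uv≢0 = ⊥-elim (uv≢0 refl)
same-component (end _ _) (cyc _)    uv≢0 = ⊥-elim (uv≢0 refl)
same-component (end j _) (end j′ _) uv≢0 with j Fin.≟ j′
... | yes refl = refl
... | no _     = ⊥-elim (uv≢0 refl)

three-in-component⇒cycle : {t : ℕ} {u v w : Vertex t} →
  component u ≡ component v → component u ≡ component w → u ≢ v → u ≢ w → v ≢ w →
  component u ≡ nothing
three-in-component⇒cycle {u = cyc _} _ _ _ _ _ = refl
three-in-component⇒cycle {u = end _ _} {cyc _} () _ _ _ _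
three-in-component⇒cycle {u = end _ _} {end _ _} {cyc _} _ () _ _ _
three-in-component⇒cycle {u = end _ a} {end _ b} {end _ c} refl refl u≢v u≢w v≢w
  with Fin2-pigeonhole a b c
... | inj₁ refl        = ⊥-elim (u≢v refl)
... | inj₂ (inj₁ refl) = ⊥-elim (u≢w refl)
... | inj₂ (inj₂ refl) = ⊥-elim (v≢w refl)

-- The value on matching vertices is junk.
cycle-position : {t : ℕ} → Vertex t → Fin 4
cycle-position (cyc i)   = i
cycle-position (end _ _) = 0F

cycle-position-cyc : {t : ℕ} (v : Vertex t) → component v ≡ nothing → cyc (cycle-position v) ≡ v
cycle-position-cyc (cyc _) _ = refl

at-most-four-in-cycle : {t : ℕ} (f : Fin 5 → Vertex t) → Injective _≡_ _≡_ f →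
  ¬ (∀ i → component (f i) ≡ nothing)
at-most-four-in-cycle f f-injective in-cycle =
  let i , j , i<j , same-position = Fin.pigeonhole (ℕ.n<1+n 4) (cycle-position ∘ f)
  in Fin.<-irrefl (f-injective (trans (sym (cycle-position-cyc (f i) (in-cycle i)))
       (trans (cong cyc same-position) (cycle-position-cyc (f j) (in-cycle j))))) i<j

at-most-two-neighbours : {t : ℕ} (b u v w : Vertex t) →
  colour b u ≢ 0 → colour b v ≢ 0 → colour b w ≢ 0 → u ≢ v → u ≢ w → v ≢ w → ⊥
at-most-two-neighbours (cyc i) (cyc u) (cyc v) (cyc w) bu≢0 bv≢0 bw≢0 u≢v u≢w v≢w =
  [ u≢v ∘ cong cyc , [ u≢w ∘ cong cyc , v≢w ∘ cong cyc ]′ ]′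
    (C4-two-neighbours i u v w bu≢0 bv≢0 bw≢0)
at-most-two-neighbours (cyc _) (end _ _) _ _ bu≢0 _ _ _ _ _ = bu≢0 refl
at-most-two-neighbours (cyc _) (cyc _) (end _ _) _ _ bv≢0 _ _ _ _ = bv≢0 refl
at-most-two-neighbours (cyc _) (cyc _) (cyc _) (end _ _) _ _ bw≢0 _ _ _ = bw≢0 refl
at-most-two-neighbours b@(end _ _) u v w bu≢0 bv≢0 bw≢0 u≢v u≢w v≢w =
  case trans bu (three-in-component⇒cycle (trans (sym bu) (same-component b v bv≢0))
                   (trans (sym bu) (same-component b w bw≢0)) u≢v u≢w v≢w) of λ ()
  where
  bu = same-component b u bu≢0

InCycle : {t : ℕ} → Vertex t → Set
InCycle v = component v ≡ nothing

cherry-in-cycle : {t : ℕ} {u v w : Vertex t} → colour u v ≢ 0 → colour v w ≢ 0 →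
  u ≢ v → u ≢ w → v ≢ w → InCycle u × InCycle v × InCycle w
cherry-in-cycle {u = u} {v} {w} uv≢0 vw≢0 u≢v u≢w v≢w =
  u∈C , trans (sym uv) u∈C , trans (sym (trans uv vw)) u∈C
  where
  uv = same-component u v uv≢0
  vw = same-component v w vw≢0
  u∈C = three-in-component⇒cycle uv (trans uv vw) u≢v u≢w v≢w

colour-S311-free : {t : ℕ} → ¬ RainbowCopy S311 (colour {t})
colour-S311-free (ψ , ψ-injective , κ-injective) = absurd
  where
  κ : Fin 5 → ℕ
  κ r = colour (ψ (proj₁ (edge S311 r))) (ψ (proj₂ (edge S311 r)))

  others-nonzero : ∀ r → κ r ≡ 0 → ∀ s → s ≢ r → κ s ≢ 0
  others-nonzero _ κr≡0 _ s≢r κs≡0 = s≢r (κ-injective (trans κs≡0 (sym κr≡0)))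

  flip : ∀ i j → colour (ψ i) (ψ j) ≢ 0 → colour (ψ j) (ψ i) ≢ 0
  flip i j ij≢0 = ij≢0 ∘ trans (colour-sym (ψ i) (ψ j))

  apart : ∀ i j → i ≢ j → ψ i ≢ ψ j
  apart _ _ i≢j = i≢j ∘ ψ-injective

  without : (i : Fin 6) → Injective _≡_ _≡_ (ψ ∘ punchIn i)
  without i = Fin.punchIn-injective i _ _ ∘ ψ-injective

  long-leg : κ 1F ≢ 0 → κ 2F ≢ 0 → InCycle (ψ 1F) × InCycle (ψ 2F) × InCycle (ψ 3F)
  long-leg κ₁≢0 κ₂≢0 =
    cherry-in-cycle κ₁≢0 κ₂≢0 (apart 1F 2F λ ()) (apart 1F 3F λ ()) (apart 2F 3F λ ())

  absurd : ⊥
  absurd with κ 0F ℕ.≟ 0 | κ 3F ℕ.≟ 0 | κ 4F ℕ.≟ 0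
  ... | yes κ₀≡0 | _ | _ =
    let q₁∈C , b∈C , q₂∈C = cherry-in-cycle (flip 0F 4F (nonzero 3F λ ())) (nonzero 4F λ ())
                              (apart 4F 0F λ ()) (apart 4F 5F λ ()) (apart 0F 5F λ ())
        p₁∈C , p₂∈C , _ = long-leg (nonzero 1F λ ()) (nonzero 2F λ ())
    in at-most-four-in-cycle (ψ ∘ punchIn 3F) (without 3F) λ where
         0F → b∈C ; 1F → p₁∈C ; 2F → p₂∈C ; 3F → q₁∈C ; 4F → q₂∈C
    where nonzero = others-nonzero 0F κ₀≡0
  ... | no κ₀≢0 | yes κ₃≡0 | _ =
    let p₁∈C , b∈C , q₂∈C = cherry-in-cycle (flip 0F 1F κ₀≢0) (nonzero 4F λ ())
                              (apart 1F 0F λ ()) (apart 1F 5F λ ()) (apart 0F 5F λ ())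
        _ , p₂∈C , p₃∈C = long-leg (nonzero 1F λ ()) (nonzero 2F λ ())
    in at-most-four-in-cycle (ψ ∘ punchIn 4F) (without 4F) λ where
         0F → b∈C ; 1F → p₁∈C ; 2F → p₂∈C ; 3F → p₃∈C ; 4F → q₂∈C
    where nonzero = others-nonzero 3F κ₃≡0
  ... | no κ₀≢0 | no _ | yes κ₄≡0 =
    let p₁∈C , b∈C , q₁∈C = cherry-in-cycle (flip 0F 1F κ₀≢0) (nonzero 3F λ ())
                              (apart 1F 0F λ ()) (apart 1F 4F λ ()) (apart 0F 4F λ ())
        _ , p₂∈C , p₃∈C = long-leg (nonzero 1F λ ()) (nonzero 2F λ ())
    in at-most-four-in-cycle (ψ ∘ punchIn 5F) (without 5F) λ where
         0F → b∈C ; 1F → p₁∈C ; 2F → p₂∈C ; 3F → p₃∈C ; 4F → q₁∈C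
    where nonzero = others-nonzero 4F κ₄≡0
  ... | no κ₀≢0 | no κ₃≢0 | no κ₄≢0 =
    at-most-two-neighbours (ψ 0F) (ψ 1F) (ψ 4F) (ψ 5F) κ₀≢0 κ₃≢0 κ₄≢0
      (apart 1F 4F λ ()) (apart 1F 5F λ ()) (apart 4F 5F λ ())

module Counterexample (t : ℕ) where

  encoding : Fin (4 + t * 2) ↔ Vertex t
  encoding = ↔-trans +↔⊎ (↔-refl ⊎-↔ *↔×)

  open Inverse encoding using (to; from; strictlyInverseˡ)

  to-injective : Injective _≡_ _≡_ to
  to-injective = Injection.injective (↔⇒↣ encoding)

  from-injective : Injective _≡_ _≡_ from
  from-injective = Injection.injective (↔⇒↣ (↔-sym encoding))

  c : Fin (4 + t * 2) → Fin (4 + t * 2) → ℕ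
  c i j = colour (to i) (to j)

  c-from : ∀ u v → c (from u) (from v) ≡ colour u v
  c-from u v = cong₂ colour (strictlyInverseˡ u) (strictlyInverseˡ v)

  c-sym : Symmetric c
  c-sym i j = colour-sym (to i) (to j)

  c-colours : AtLeastColours t c
  c-colours =
    (λ j → from (end j 0F) , from (end j 1F)) ,
    (λ j → (λ ()) ∘ from-injective {end j 0F} {end j 1F}) ,
    λ eq → Fin.toℕ-injective (ℕ.+-cancelˡ-≡ 5 _ _
             (trans (sym (matching-edge _)) (trans eq (matching-edge _))))
    where
    matching-edge : ∀ j → c (from (end j 0F)) (from (end j 1F)) ≡ 5 + toℕ j
    matching-edge j = trans (c-from (end j 0F) (end j 1F)) (matching-colour j)

  c-S311-free : RainbowFree S311 c
  c-S311-free =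
    colour-S311-free ∘ rainbowCopy-map {col = c} {col′ = colour} S311 to to-injective (λ _ _ → refl)

  c-rainbow-C4 : HasRainbow (Cycle 4) c
  c-rainbow-C4 = rainbowCopy-map {col = colour} {col′ = c} (Cycle 4) from from-injective c-from
    (cyc , inj₁-injective , C4-rainbow _ _)

S311⋠C4 : ¬ (S311 ≼ Cycle 4)
S311⋠C4 (t , _ , S311-free⇒C4-free) =
  S311-free⇒C4-free (4 + t * 2) c c-sym c-colours c-S311-free c-rainbow-C4
  where open Counterexample t

-- Colourings containing a rainbow Cₖ, k ≥ 5

module _ {n s : ℕ} (c : Fin n → Fin n → ℕ) (φ : Fin s → Fin n) where

  Chord : ℕ → Set
  Chord γ = ∃ λ a → ∃ λ b → γ ≡ c (φ a) (φ b)

  chord? : ∀ γ → Dec (Chord γ)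
  chord? γ = Fin.any? λ a → Fin.any? λ b → γ ℕ.≟ c (φ a) (φ b)

  at-most-s²-chord-colours : (f : Fin (ℕ.suc (s * s)) → ℕ) → Injective _≡_ _≡_ f →
    ¬ (∀ r → Chord (f r))
  at-most-s²-chord-colours f f-injective chords =
    let r , r′ , r<r′ , same-position = Fin.pigeonhole (ℕ.n<1+n (s * s)) position
    in Fin.<-irrefl (f-injective (same-colour r r′ same-position)) r<r′
    where
    position : Fin (ℕ.suc (s * s)) → Fin (s * s)
    position r = Fin.combine (proj₁ (chords r)) (proj₁ (proj₂ (chords r)))
    same-colour : ∀ r r′ → position r ≡ position r′ → f r ≡ f r′
    same-colour r r′ eq =
      let a , b , fr≡ = chords r ; a′ , b′ , fr′≡ = chords r′
          a≡a′ , b≡b′ = Fin.combine-injective a b a′ b′ eq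
      in trans fr≡ (trans (cong₂ (λ a b → c (φ a) (φ b)) a≡a′ b≡b′) (sym fr′≡))

  new-colour-edge : AtLeastColours (ℕ.suc (s * s)) c → ∃ λ x → ∃ λ y → x ≢ y × ¬ Chord (c x y)
  new-colour-edge (f , f-proper , f-rainbow)
    with Fin.all? (λ r → chord? (c (proj₁ (f r)) (proj₂ (f r))))
  ... | yes chords  = ⊥-elim (at-most-s²-chord-colours _ f-rainbow chords)
  ... | no ¬chords =
    let r , ¬chord = Fin.¬∀⟶∃¬ _ _ (λ r → chord? _) ¬chords
    in proj₁ (f r) , proj₂ (f r) , f-proper r , ¬chord

%-shift-≢ : ∀ {k d} j .{{_ : NonZero k}} → 0 < d → d < k → (d + j) % k ≢ j % k
%-shift-≢ {k} {d} j 0<d d<k [d+j]%k≡j%k =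
  ℕ.<⇒≱ d<k (∣⇒≤ {{ℕ.>-nonZero 0<d}} (divides ((d + r) / k) d≡q*k))
  where
  r = j % k
  [d+r]%k≡r : (d + r) % k ≡ r
  [d+r]%k≡r = begin
    (d + r) % k         ≡⟨ cong (λ d′ → (d′ + r) % k) (sym (m<n⇒m%n≡m d<k)) ⟩
    (d % k + j % k) % k ≡⟨ %-distribˡ-+ d j k ⟨
    (d + j) % k         ≡⟨ [d+j]%k≡j%k ⟩
    r                   ∎
  d≡q*k : d ≡ (d + r) / k * k
  d≡q*k = ℕ.+-cancelʳ-≡ r d _ (begin
    d + r                         ≡⟨ m≡m%n+[m/n]*n (d + r) k ⟩
    (d + r) % k + (d + r) / k * k ≡⟨ cong (_+ (d + r) / k * k) [d+r]%k≡r ⟩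
    r + (d + r) / k * k           ≡⟨ ℕ.+-comm r _ ⟩
    (d + r) / k * k + r           ∎)

Ahead : ℕ → ℕ → Set
Ahead i j = 0 < i ∸ j × i ∸ j < 5

ahead? : ∀ i j → Dec (Ahead i j)
ahead? i j = 0 ℕ.<? i ∸ j ×-dec i ∸ j ℕ.<? 5

Near : ℕ → ℕ → Set
Near i j = Ahead i j ⊎ Ahead j i

near? : ∀ i j → Dec (Near i j)
near? i j = ahead? i j ⊎-dec ahead? j i

module RainbowCycle {n : ℕ} (c : Fin n → Fin n → ℕ) (c-sym : Symmetric c) (free : RainbowFree S311 c)
  (m : ℕ) (φ : Fin (5 + m) → Fin n) (φ-injective : Injective _≡_ _≡_ φ)
  (φ-rainbow : Injective _≡_ _≡_ (λ i → c (φ i) (φ (ℕ.suc (toℕ i) mod (5 + m)))))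
  where

  k : ℕ
  k = 5 + m

  w : ℕ → Fin n
  w p = φ (p mod k)

  e : ℕ → ℕ
  e p = c (w p) (w (ℕ.suc p))

  OffCycle : Fin n → Set
  OffCycle x = ∀ a → x ≢ φ a

  New : ℕ → Set
  New γ = ¬ Chord c φ γ

  private
    toℕ-mod : ∀ p → toℕ (p mod k) ≡ p % k
    toℕ-mod p = Fin.toℕ-fromℕ< (m%n<n p k)

    suc-mod : ∀ p → ℕ.suc (toℕ (p mod k)) mod k ≡ ℕ.suc p mod k
    suc-mod p = Fin.toℕ-injective (begin
      toℕ (ℕ.suc (toℕ (p mod k)) mod k) ≡⟨ toℕ-mod (ℕ.suc (toℕ (p mod k))) ⟩
      ℕ.suc (toℕ (p mod k)) % k         ≡⟨ cong (λ r → ℕ.suc r % k) (toℕ-mod p) ⟩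
      ℕ.suc (p % k) % k                 ≡⟨ %-distribˡ-+ 1 p k ⟨
      ℕ.suc p % k                       ≡⟨ toℕ-mod (ℕ.suc p) ⟨
      toℕ (ℕ.suc p mod k)               ∎)

  w-periodic : ∀ a → w (k + toℕ a) ≡ φ a
  w-periodic a = cong φ (Fin.toℕ-injective (begin
    toℕ ((k + toℕ a) mod k) ≡⟨ toℕ-mod (k + toℕ a) ⟩
    (k + toℕ a) % k         ≡⟨ cong (_% k) (ℕ.+-comm k (toℕ a)) ⟩
    (toℕ a + k) % k         ≡⟨ [m+n]%n≡m%n (toℕ a) k ⟩
    toℕ a % k               ≡⟨ m<n⇒m%n≡m (Fin.toℕ<n a) ⟩
    toℕ a                   ∎))

  w-apart : ∀ {d} p → 0 < d → d < k → w (d + p) ≢ w p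
  w-apart {d} p 0<d d<k eq = %-shift-≢ p 0<d d<k (begin
    (d + p) % k         ≡⟨ toℕ-mod (d + p) ⟨
    toℕ ((d + p) mod k) ≡⟨ cong toℕ (φ-injective eq) ⟩
    toℕ (p mod k)       ≡⟨ toℕ-mod p ⟩
    p % k               ∎)

  e-apart : ∀ {d} p → 0 < d → d < k → e (d + p) ≢ e p
  e-apart {d} p 0<d d<k eq = %-shift-≢ p 0<d d<k (begin
    (d + p) % k         ≡⟨ toℕ-mod (d + p) ⟨
    toℕ ((d + p) mod k) ≡⟨ cong toℕ (φ-rainbow (trans (cycle-edge (d + p))
                                                    (trans eq (sym (cycle-edge p))))) ⟩
    toℕ (p mod k)       ≡⟨ toℕ-mod p ⟩
    p % k               ∎)
    where
    cycle-edge : ∀ q → c (φ (q mod k)) (φ (ℕ.suc (toℕ (q mod k)) mod k)) ≡ e q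
    cycle-edge q = cong (c (w q) ∘ φ) (suc-mod q)

  private
    ahead-apart : {A : Set} (f : ℕ → A) → (∀ {d} p → 0 < d → d < k → f (d + p) ≢ f p) →
      ∀ {i j} o → Ahead i j → f (i + o) ≢ f (j + o)
    ahead-apart f f-apart {i} {j} o (0<d , d<5) =
      subst (λ x → f x ≢ f (j + o)) shift (f-apart (j + o) 0<d (ℕ.<-≤-trans d<5 (ℕ.m≤m+n 5 m)))
      where
      shift : i ∸ j + (j + o) ≡ i + o
      shift = trans (sym (ℕ.+-assoc (i ∸ j) j o))
                (cong (_+ o) (ℕ.m∸n+n≡m (ℕ.<⇒≤ (ℕ.m∸n≢0⇒n<m {i} {j} (ℕ.>⇒≢ 0<d)))))

  near-apart : {A : Set} (f : ℕ → A) → (∀ {d} p → 0 < d → d < k → f (d + p) ≢ f p) →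
    ∀ {i j} o → Near i j → f (i + o) ≢ f (j + o)
  near-apart f f-apart o (inj₁ i-ahead) = ahead-apart f f-apart o i-ahead
  near-apart f f-apart o (inj₂ j-ahead) = ≢-sym (ahead-apart f f-apart o j-ahead)

  -- Configurations are written with symbolic vertices (V i for the off-cycle vertex u i,
  -- W j for the cycle vertex w (j + o)) and colours (Γ for the new colour γ, E j for the
  -- cycle colour e (j + o)).  Two W's or two E's count as apart when their indices differ
  -- by 1 to 4, which is sound as k ≥ 5.  Apartness is decidable, so the fifteen vertex and
  -- ten colour inequalities of a spider are discharged by evaluation in the implicit
  -- True-arguments.
  module Symbolic {l : ℕ} (u : Fin l → Fin n) (u-injective : Injective _≡_ _≡_ u)
    (u-off : ∀ i → OffCycle (u i)) (γ : ℕ) (γ-new : New γ) where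

    data Point : Set where
      V : Fin l → Point
      W : ℕ → Point

    data Colour : Set where
      Γ : Colour
      E : ℕ → Colour

    PointApart : Point → Point → Set
    PointApart (V i) (V j) = i ≢ j
    PointApart (W i) (W j) = Near i j
    PointApart _     _     = ⊤

    point-apart? : ∀ p q → Dec (PointApart p q)
    point-apart? (V i) (V j) = ¬? (i Fin.≟ j)
    point-apart? (V _) (W _) = yes tt
    point-apart? (W _) (V _) = yes tt
    point-apart? (W i) (W j) = near? i j

    ColourApart : Colour → Colour → Set
    ColourApart Γ     Γ     = ⊥
    ColourApart (E i) (E j) = Near i j
    ColourApart _     _     = ⊤

    colour-apart? : ∀ κ κ′ → Dec (ColourApart κ κ′)
    colour-apart? Γ     Γ     = no λ ()
    colour-apart? Γ     (E _) = yes tt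
    colour-apart? (E _) Γ     = yes tt
    colour-apart? (E i) (E j) = near? i j

    module _ (o : ℕ) where

      ⟦_⟧ : Point → Fin n
      ⟦ V i ⟧ = u i
      ⟦ W j ⟧ = w (j + o)

      ⟦_⟧ᶜ : Colour → ℕ
      ⟦ Γ ⟧ᶜ   = γ
      ⟦ E j ⟧ᶜ = e (j + o)

      point-apart-sound : ∀ {p q} → PointApart p q → ⟦ p ⟧ ≢ ⟦ q ⟧
      point-apart-sound {V _} {V _} i≢j  = i≢j ∘ u-injective
      point-apart-sound {V i} {W _} _    = u-off i _
      point-apart-sound {W _} {V j} _    = ≢-sym (u-off j _)
      point-apart-sound {W i} {W j} near = near-apart w w-apart {i} {j} o near

      colour-apart-sound : ∀ {κ κ′} → ColourApart κ κ′ → ⟦ κ ⟧ᶜ ≢ ⟦ κ′ ⟧ᶜ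
      colour-apart-sound {Γ}   {E _} _ eq = γ-new (_ , _ , eq)
      colour-apart-sound {E _} {Γ}   _ eq = γ-new (_ , _ , sym eq)
      colour-apart-sound {E i} {E j} near = near-apart e e-apart {i} {j} o near

      colours-apart : ∀ κ κ′ → {True (colour-apart? κ κ′)} → ⟦ κ ⟧ᶜ ≢ ⟦ κ′ ⟧ᶜ
      colours-apart _ _ {apart} = colour-apart-sound (toWitness apart)

      colour-not-among : ∀ κ κs → {True (All.all? (colour-apart? κ) κs)} → ⟦ κ ⟧ᶜ ∉ map ⟦_⟧ᶜ κs
      colour-not-among _ _ {apart} =
        All¬⇒¬Any (All.map⁺ (All.map colour-apart-sound (toWitness apart)))

      no-rainbow-S311 : (b p₁ p₂ p₃ q₁ q₂ : Point) (κ₁ κ₂ κ₃ κ₄ κ₅ : Colour) →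
        c ⟦ b ⟧ ⟦ p₁ ⟧ ≡ ⟦ κ₁ ⟧ᶜ → c ⟦ p₁ ⟧ ⟦ p₂ ⟧ ≡ ⟦ κ₂ ⟧ᶜ → c ⟦ p₂ ⟧ ⟦ p₃ ⟧ ≡ ⟦ κ₃ ⟧ᶜ →
        c ⟦ b ⟧ ⟦ q₁ ⟧ ≡ ⟦ κ₄ ⟧ᶜ → c ⟦ b ⟧ ⟦ q₂ ⟧ ≡ ⟦ κ₅ ⟧ᶜ →
        {_ : True (allPairs? point-apart? (b ∷ p₁ ∷ p₂ ∷ p₃ ∷ q₁ ∷ q₂ ∷ []))} →
        {_ : True (allPairs? colour-apart? (κ₁ ∷ κ₂ ∷ κ₃ ∷ κ₄ ∷ κ₅ ∷ []))} → ⊥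
      no-rainbow-S311 _ _ _ _ _ _ _ _ _ _ _ e₁ e₂ e₃ e₄ e₅ {points} {colours} =
        free (S311-rainbow c e₁ e₂ e₃ e₄ e₅
          (AllPairs.map⁺ (AllPairs.map point-apart-sound (toWitness points)))
          (AllPairs.map⁺ (AllPairs.map colour-apart-sound (toWitness colours))))

      last-leaf-colour : (b p₁ p₂ p₃ q₁ q₂ : Point) (κ₁ κ₂ κ₃ κ₄ : Colour) →
        c ⟦ b ⟧ ⟦ p₁ ⟧ ≡ ⟦ κ₁ ⟧ᶜ → c ⟦ p₁ ⟧ ⟦ p₂ ⟧ ≡ ⟦ κ₂ ⟧ᶜ → c ⟦ p₂ ⟧ ⟦ p₃ ⟧ ≡ ⟦ κ₃ ⟧ᶜ →
        c ⟦ b ⟧ ⟦ q₁ ⟧ ≡ ⟦ κ₄ ⟧ᶜ →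
        {_ : True (allPairs? point-apart? (b ∷ p₁ ∷ p₂ ∷ p₃ ∷ q₁ ∷ q₂ ∷ []))} →
        {_ : True (allPairs? colour-apart? (κ₁ ∷ κ₂ ∷ κ₃ ∷ κ₄ ∷ []))} →
        c ⟦ b ⟧ ⟦ q₂ ⟧ ∈ map ⟦_⟧ᶜ (κ₁ ∷ κ₂ ∷ κ₃ ∷ κ₄ ∷ [])
      last-leaf-colour _ _ _ _ _ _ _ _ _ _ e₁ e₂ e₃ e₄ {points} {colours} =
        S311-last-leaf c free e₁ e₂ e₃ e₄
          (AllPairs.map⁺ (AllPairs.map point-apart-sound (toWitness points)))
          (AllPairs.map⁺ (AllPairs.map colour-apart-sound (toWitness colours)))

    leaf-colour-forward : ∀ i o → c (w (1 + o)) (u i) ∈ e (1 + o) ∷ e (2 + o) ∷ e (3 + o) ∷ e o ∷ []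
    leaf-colour-forward i o =
      last-leaf-colour o (W 1) (W 2) (W 3) (W 4) (W 0) (V i) (E 1) (E 2) (E 3) (E 0)
        refl refl refl (c-sym _ _)

    leaf-colour-backward : ∀ i o → c (w (3 + o)) (u i) ∈ e (2 + o) ∷ e (1 + o) ∷ e o ∷ e (3 + o) ∷ []
    leaf-colour-backward i o =
      last-leaf-colour o (W 3) (W 2) (W 1) (W 0) (W 4) (V i) (E 2) (E 1) (E 0) (E 3)
        (c-sym _ _) (c-sym _ _) (c-sym _ _) refl

    -- The cycle vertex is w (3 + q) so that both of its neighbourhoods have indices in ℕ;
    -- the opposite case can only occur for k = 5, where e (5 + q) is always e q.
    data ColourTowards (i : Fin l) (q : ℕ) : Set where
      behind   : c (u i) (w (3 + q)) ≡ e (2 + q) → ColourTowards i q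
      ahead    : c (u i) (w (3 + q)) ≡ e (3 + q) → ColourTowards i q
      opposite : c (u i) (w (3 + q)) ≡ e (5 + q) → e (5 + q) ≡ e q → ColourTowards i q

    colour-towards : ∀ i q → ColourTowards i q
    colour-towards i q = both-legs (leaf-colour-forward i (2 + q)) (leaf-colour-backward i q)
      where
      both-legs : c (w (3 + q)) (u i) ∈ e (3 + q) ∷ e (4 + q) ∷ e (5 + q) ∷ e (2 + q) ∷ [] →
                  c (w (3 + q)) (u i) ∈ e (2 + q) ∷ e (1 + q) ∷ e q ∷ e (3 + q) ∷ [] →
                  ColourTowards i q
      both-legs (here σ) _ = ahead (trans (c-sym _ _) σ)
      both-legs (there (there (there (here σ)))) _ = behind (trans (c-sym _ _) σ)
      both-legs (there (here σ)) τ = ⊥-elim (colour-not-among q (E 4) (E 2 ∷ E 1 ∷ E 0 ∷ E 3 ∷ [])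
        (subst (_∈ e (2 + q) ∷ e (1 + q) ∷ e q ∷ e (3 + q) ∷ []) σ τ))
      both-legs (there (there (here σ))) (there (there (here τ))) =
        opposite (trans (c-sym _ _) σ) (trans (sym σ) τ)
      both-legs (there (there (here σ))) (here τ) =
        ⊥-elim (colours-apart q (E 5) (E 2) (trans (sym σ) τ))
      both-legs (there (there (here σ))) (there (here τ)) =
        ⊥-elim (colours-apart q (E 5) (E 1) (trans (sym σ) τ))
      both-legs (there (there (here σ))) (there (there (there (here τ)))) =
        ⊥-elim (colours-apart q (E 5) (E 3) (trans (sym σ) τ))

  new-sym : ∀ {x y} → New (c x y) → New (c y x)
  new-sym {x} {y} xy-new (a , b , yx≡) = xy-new (a , b , trans (c-sym x y) yx≡)

  no-new-colour-at-cycle : ∀ a y → ¬ New (c (φ a) y)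
  no-new-colour-at-cycle a y new =
    no-rainbow-S311 o (W 1) (W 2) (W 3) (W 4) (W 0) (V 0F) (E 1) (E 2) (E 3) (E 0) Γ
      refl refl refl (c-sym _ _) (cong (λ v → c v y) (w-periodic a))
    where
    only : Fin 1 → Fin n
    only _ = y
    only-injective : Injective _≡_ _≡_ only
    only-injective {0F} {0F} _ = refl
    only-off : ∀ i → OffCycle (only i)
    only-off _ b y≡φb = new (a , b , cong (c (φ a)) y≡φb)
    open Symbolic only only-injective only-off (c (φ a) y) new
    -- W 1 is then w (k + toℕ a) = φ a.
    o = 4 + m + toℕ a

  new-colour-off-cycle : ∀ {x y} → New (c x y) → OffCycle x × OffCycle y
  new-colour-off-cycle {x} {y} xy-new =
    (λ a x≡φa → no-new-colour-at-cycle a y (subst (λ v → New (c v y)) x≡φa xy-new)) ,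
    (λ a y≡φa → no-new-colour-at-cycle a x (subst (λ v → New (c v x)) y≡φa (new-sym xy-new)))

  module NewEdge {x y : Fin n} (x≢y : x ≢ y) (xy-new : New (c x y)) where

    endpoint : Fin 2 → Fin n
    endpoint 0F = x
    endpoint 1F = y

    endpoint-injective : Injective _≡_ _≡_ endpoint
    endpoint-injective {0F} {0F} _   = refl
    endpoint-injective {0F} {1F} x≡y = ⊥-elim (x≢y x≡y)
    endpoint-injective {1F} {0F} y≡x = ⊥-elim (x≢y (sym y≡x))
    endpoint-injective {1F} {1F} _   = refl

    endpoint-off : ∀ i → OffCycle (endpoint i)
    endpoint-off 0F = proj₁ (new-colour-off-cycle xy-new)
    endpoint-off 1F = proj₂ (new-colour-off-cycle xy-new)

    open Symbolic endpoint endpoint-injective endpoint-off (c x y) xy-new public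

    pattern X = V 0F
    pattern Y = V 1F

    k>5-absurd : 5 < k → ⊥
    k>5-absurd 5<k = by-cases (colour-towards 0F 4) (colour-towards 0F 7) (colour-towards 0F 1)
      where
      by-cases : ColourTowards 0F 4 → ColourTowards 0F 7 → ColourTowards 0F 1 → ⊥
      by-cases (opposite _ e₉≡e₄) _ _ = e-apart {5} 4 (s≤s z≤n) 5<k e₉≡e₄
      by-cases _ (opposite _ e₁₂≡e₇) _ = e-apart {5} 7 (s≤s z≤n) 5<k e₁₂≡e₇
      by-cases _ _ (opposite _ e₆≡e₁) = e-apart {5} 1 (s≤s z≤n) 5<k e₆≡e₁
      by-cases (behind σ₇) (behind σ₁₀) _ =
        no-rainbow-S311 0 X (W 7) (W 8) (W 9) (W 10) Y (E 6) (E 7) (E 8) (E 9) Γ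
          σ₇ refl refl σ₁₀ refl
      by-cases (behind σ₇) (ahead σ₁₀) _ =
        no-rainbow-S311 0 X (W 7) (W 8) (W 9) (W 10) Y (E 6) (E 7) (E 8) (E 10) Γ
          σ₇ refl refl σ₁₀ refl
      by-cases (ahead σ₇) _ (behind σ₄) =
        no-rainbow-S311 0 X (W 7) (W 6) (W 5) (W 4) Y (E 7) (E 6) (E 5) (E 3) Γ
          σ₇ (c-sym _ _) (c-sym _ _) σ₄ refl
      by-cases (ahead σ₇) _ (ahead σ₄) =
        no-rainbow-S311 0 X (W 7) (W 6) (W 5) (W 4) Y (E 7) (E 6) (E 5) (E 4) Γ
          σ₇ (c-sym _ _) (c-sym _ _) σ₄ refl

-- For k = 5 the indices of w and e reduce modulo 5 by evaluation, so a configuration may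
-- name a cycle vertex or colour by any representative (W 8 for w 3, E 9 for e 4); the
-- representatives below are chosen so that the apartness check sees the distinct ones.
module Pentagon {n : ℕ} (c : Fin n → Fin n → ℕ) (c-sym : Symmetric c) (free : RainbowFree S311 c)
  (φ : Fin 5 → Fin n) (φ-injective : Injective _≡_ _≡_ φ)
  (φ-rainbow : Injective _≡_ _≡_ (λ i → c (φ i) (φ (ℕ.suc (toℕ i) mod 5))))
  where

  open RainbowCycle c c-sym free 0 φ φ-injective φ-rainbow

  module _ {x y : Fin n} (x≢y : x ≢ y) (xy-new : New (c x y)) where
    open NewEdge x≢y xy-new

    private
      opposite-unless : ∀ {q} → ColourTowards 0F q →
        c x (w (3 + q)) ≢ e (2 + q) → c x (w (3 + q)) ≢ e (3 + q) → c x (w (3 + q)) ≡ e (5 + q)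
      opposite-unless (behind σ)     ¬behind _      = ⊥-elim (¬behind σ)
      opposite-unless (ahead σ)      _       ¬ahead = ⊥-elim (¬ahead σ)
      opposite-unless (opposite σ _) _       _      = σ

      refute : ∀ {q} → ColourTowards 0F q → c x (w (3 + q)) ≢ e (2 + q) →
        c x (w (3 + q)) ≢ e (3 + q) → c x (w (3 + q)) ≢ e (5 + q) → ⊥
      refute (behind σ)     ¬behind _      _         = ¬behind σ
      refute (ahead σ)      _       ¬ahead _         = ¬ahead σ
      refute (opposite σ _) _       _      ¬opposite = ¬opposite σ

    opposite₅ : c x (w 5) ≡ e 7
    opposite₅ = opposite-unless (colour-towards 0F 2)
      (λ σ₅ → refute (colour-towards 0F 0)
        (λ σ₃ → no-rainbow-S311 0 X (W 5) (W 6) (W 7) (W 8) Y (E 4) (E 5) (E 6) (E 7) Γ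
                  σ₅ refl refl σ₃ refl)
        (λ σ₃ → no-rainbow-S311 0 X (W 5) (W 6) (W 7) (W 8) Y (E 4) (E 5) (E 6) (E 8) Γ
                  σ₅ refl refl σ₃ refl)
        (λ σ₃ → no-rainbow-S311 0 X (W 8) (W 7) (W 6) (W 5) Y (E 5) (E 7) (E 6) (E 4) Γ
                  σ₃ (c-sym _ _) (c-sym _ _) σ₅ refl))
      (λ σ₅ → refute (colour-towards 0F 4)
        (λ σ₇ → no-rainbow-S311 0 X (W 5) (W 4) (W 3) (W 7) Y (E 5) (E 4) (E 3) (E 6) Γ
                  σ₅ (c-sym _ _) (c-sym _ _) σ₇ refl)
        (λ σ₇ → no-rainbow-S311 0 X (W 5) (W 4) (W 3) (W 7) Y (E 5) (E 4) (E 3) (E 7) Γ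
                  σ₅ (c-sym _ _) (c-sym _ _) σ₇ refl)
        (λ σ₇ → no-rainbow-S311 0 X (W 7) (W 8) (W 9) (W 5) Y (E 9) (E 7) (E 8) (E 5) Γ
                  σ₇ refl refl σ₅ refl))

    opposite₆ : c x (w 6) ≡ e 8
    opposite₆ = opposite-unless (colour-towards 0F 3)
      (λ σ₆ → no-rainbow-S311 0 X (W 5) (W 4) (W 3) (W 6) Y (E 7) (E 4) (E 3) (E 5) Γ
                opposite₅ (c-sym _ _) (c-sym _ _) σ₆ refl)
      (λ σ₆ → no-rainbow-S311 0 X (W 5) (W 4) (W 3) (W 6) Y (E 7) (E 4) (E 3) (E 6) Γ
                opposite₅ (c-sym _ _) (c-sym _ _) σ₆ refl)

    opposite₄ : c x (w 4) ≡ e 6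
    opposite₄ = opposite-unless (colour-towards 0F 1)
      (λ σ₄ → no-rainbow-S311 0 X (W 5) (W 6) (W 7) (W 9) Y (E 7) (E 5) (E 6) (E 8) Γ
                opposite₅ refl refl σ₄ refl)
      (λ σ₄ → no-rainbow-S311 0 X (W 5) (W 6) (W 7) (W 9) Y (E 7) (E 5) (E 6) (E 9) Γ
                opposite₅ refl refl σ₄ refl)

    opposite₇ : c x (w 7) ≡ e 9
    opposite₇ = opposite-unless (colour-towards 0F 4)
      (λ σ₇ → no-rainbow-S311 0 X (W 5) (W 4) (W 3) (W 7) Y (E 7) (E 4) (E 3) (E 6) Γ
                opposite₅ (c-sym _ _) (c-sym _ _) σ₇ refl)
      (λ σ₇ → no-rainbow-S311 0 X (W 4) (W 5) (W 6) (W 7) Y (E 6) (E 4) (E 5) (E 7) Γ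
                opposite₄ refl refl σ₇ refl)

    opposite₃ : c x (w 3) ≡ e 5
    opposite₃ = opposite-unless (colour-towards 0F 0)
      (λ σ₃ → no-rainbow-S311 0 X (W 6) (W 5) (W 4) (W 8) Y (E 8) (E 5) (E 4) (E 7) Γ
                opposite₆ (c-sym _ _) (c-sym _ _) σ₃ refl)
      (λ σ₃ → no-rainbow-S311 0 X (W 5) (W 6) (W 7) (W 8) Y (E 7) (E 5) (E 6) (E 8) Γ
                opposite₅ refl refl σ₃ refl)

  no-new-colour₅ : ∀ {x y} → x ≢ y → ¬ New (c x y)
  no-new-colour₅ {x} {y} x≢y xy-new =
    no-rainbow-S311 0 X Y (W 3) (W 4) (W 5) (W 7) Γ (E 5) (E 3) (E 7) (E 4)
      refl (opposite₃ (≢-sym x≢y) (new-sym xy-new)) refl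
      (opposite₅ x≢y xy-new) (opposite₇ x≢y xy-new)
    where open NewEdge x≢y xy-new

no-new-colour : ∀ m {n} {c : Fin n → Fin n → ℕ} → Symmetric c → RainbowFree S311 c →
  (C : HasRainbow (Cycle (5 + m)) c) → ∀ {x y} → x ≢ y → ¬ ¬ Chord c (proj₁ C) (c x y)
no-new-colour ℕ.zero c-sym free (φ , φ-injective , φ-rainbow) =
  Pentagon.no-new-colour₅ _ c-sym free φ φ-injective φ-rainbow
no-new-colour (ℕ.suc m) c-sym free (φ , φ-injective , φ-rainbow) x≢y xy-new =
  NewEdge.k>5-absurd x≢y xy-new (s≤s (s≤s (s≤s (s≤s (s≤s (s≤s z≤n))))))
  where open RainbowCycle _ c-sym free (ℕ.suc m) φ φ-injective φ-rainbow

S311≼C≥5 : (k : ℕ) → 5 ≤ k → S311 ≼ Cycle k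
S311≼C≥5 (ℕ.suc (ℕ.suc (ℕ.suc (ℕ.suc (ℕ.suc m))))) (s≤s (s≤s (s≤s (s≤s (s≤s z≤n))))) =
  ℕ.suc ((5 + m) * (5 + m)) , s≤s z≤n , λ n c c-sym colours free C →
    let x , y , x≢y , xy-new = new-colour-edge c (proj₁ C) colours
    in no-new-colour m c-sym free C x≢y xy-new

theorem13 : (¬ (S311 ≼ Cycle 4)) × ((k : ℕ) → 5 ≤ k → S311 ≼ Cycle k)
theorem13 = S311⋠C4 , S311≼C≥5
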